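{- For any $\sigma\in0\{0,1\}^{n-1}$, $$F(Q_\sigma,\mathbf{x})\cdot L_1=F(Q_{\sigma0},\mathbf{x})+\sum_{\tau<_{lex}\sigma0}c_\tau F(Q_\tau,\mathbf{x})$$ for some nonnegative integers $c_\tau$, where $\tau$ ranges over $0\{0,1\}^{n}$ and $L_1=x_1+x_2+x_3+\cdots$.
   Context: A labelled poset on $[n]$ is a partial order $<_P$ on the set $[n]$. A $P$-partition is $f:[n]\to\mathbb{P}=\{1,2,\ldots\}$ with $f(i)\le f(i')$ whenever $i\le_Pi'$ and $f(i)<f(i')$ whenever $i\le_Pi'$ and $i>i'$ as integers; $F(P,\mathbf{x})=\sum_f\prod_ix_{f(i)}$ over all $P$-partitions. For labelled posets $P_1,P_2$ on disjoint label sets, $P_1\oplus P_2$ is their disjoint union with the additional relations $p_1<p_2$ for all $p_1\in P_1,p_2\in P_2$. $0\{0,1\}^{k-1}$ is the set of binary strings of length $k$ beginning with $0$, ordered lexicographically with $0<1$; $\sigma0$ denotes $\sigma$ with $0$ appended. The labelled posets $Q_\sigma$ on $[k]$ (for $\sigma$ of length $k$) are defined recursively: if $\sigma$ consists of $k$ zeroes, $Q_\sigma$ is the antichain on $[k]$; if $\sigma=\hat\sigma1$ with $\hat\sigma$ of length $k-1$, then $Q_\sigma=Q_{\hat\sigma}\oplus(k)$ with $(k)$ the one-element poset labelled $k$; if $\sigma=\hat\sigma0$ is not all zeroes, $Q_\sigma$ is obtained from $Q_{\hat\sigma}$ by adding a new element labelled $k$ with the single new relation $k-1<k$ (plus those implied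 by transitivity), then swapping the labels $k-1$ and $k$. -}

module Defs where

open import Data.Bool using (Bool; true; false; _∧_; _∨_; not; if_then_else_)
open import Data.Nat using (ℕ; zero; suc; _+_; _*_; _∸_; _≡ᵇ_; _<ᵇ_)
open import Data.Fin using (Fin; toℕ)
open import Data.List as L using (List; []; _∷_; length; concatMap; allFin) renaming (filterᵇ to filter)
open import Data.Bool.ListAction using (and)
open import Data.Nat.ListAction using (sum)
open import Data.Vec as V using (Vec; []; _∷_; reverse; toList; lookup; _[_]%=_)
open import Function using (_∘_)
open import Relation.Nullary.Decidable using (Dec; yes; no)
open import Relation.Binary.PropositionalEquality using (_≡_)

-- We use 0-indexed labels 0..k-1 (label i here
-- stands for label i+1 of the paper; this preserves the integer order of
-- labels).  A poset on [k] is given by its (reflexive) order relation as a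
-- Boolean-valued function on ℕ; only arguments < k are ever consulted.

Rel : Set
Rel = ℕ → ℕ → Bool

allZero : List Bool → Bool
allZero []          = true
allZero (true ∷ _)  = false
allZero (false ∷ b) = allZero b

-- Q built from the REVERSED word: (b ∷ ρ) encodes σ = (reverse ρ) b,
-- i.e. b is the last letter of σ.  The new element gets label k' = length ρ.
Qrev : List Bool → Rel
Qrev [] i j = i ≡ᵇ j
Qrev (b ∷ ρ) with allZero (b ∷ ρ)
... | true  = λ i j → i ≡ᵇ j
Qrev (true ∷ ρ)  | false = λ i j →
  (j ≡ᵇ length ρ) ∨ (not (i ≡ᵇ length ρ) ∧ Qrev ρ i j)
Qrev (false ∷ ρ) | false = λ i j → leq' (sw i) (sw j)
  where
    k' = length ρ
    old = Qrev ρ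
    -- add new element k' with the single cover relation (k'-1) < k'
    leq' : Rel
    leq' i j = ((j ≡ᵇ k') ∧ ((i ≡ᵇ k') ∨ old i (k' ∸ 1)))
             ∨ (not (j ≡ᵇ k') ∧ not (i ≡ᵇ k') ∧ old i j)
    sw : ℕ → ℕ
    sw i = if i ≡ᵇ k' then k' ∸ 1 else (if i ≡ᵇ (k' ∸ 1) then k' else i)

Q : ∀ {k} → Vec Bool k → Rel
Q σ = Qrev (toList (reverse σ))

-- P-partitions with values in {1..m} (value v : Fin m stands for v+1).

finList : ∀ k → List (Fin k)
finList k = allFin k

allVecs : (A : Set) → List A → (k : ℕ) → List (Vec A k)
allVecs A xs zero    = [] ∷ []
allVecs A xs (suc k) = concatMap (λ x → L.map (x ∷_) (allVecs A xs k)) xs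

_≤ᵇ'_ : ℕ → ℕ → Bool
a ≤ᵇ' b = a <ᵇ suc b

isPPartition : ∀ {k m} → Rel → Vec (Fin m) k → Bool
isPPartition {k} P f = and (L.map (λ i → and (L.map (λ j → cond i j) (finList k))) (finList k))
  where
    cond : Fin _ → Fin _ → Bool
    cond i j = if P (toℕ i) (toℕ j)
               then (if toℕ j <ᵇ toℕ i
                     then toℕ (lookup f i) <ᵇ toℕ (lookup f j)
                     else toℕ (lookup f i) ≤ᵇ' toℕ (lookup f j))
               else true

-- exponent vector of the monomial ∏_i x_{f(i)} (in variables x_1..x_m)
content : ∀ {k m} → Vec (Fin m) k → Vec ℕ m
content {m = m} []      = V.replicate m 0
content {m = m} (v ∷ f) = content f [ v ]%= suc

eqVec : ∀ {m} → Vec ℕ m → Vec ℕ m → Bool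
eqVec []       []       = true
eqVec (a ∷ as) (b ∷ bs) = (a ≡ᵇ b) ∧ eqVec as bs

-- Coefficient of x^α (α an exponent vector in x_1..x_m) in F(P, x) for a
-- labelled poset P on [k]: the number of P-partitions f with content α.
-- (Any monomial only involves finitely many variables, so these
-- coefficients for all m and α determine F(P,x).)
coeffF : (k : ℕ) → Rel → (m : ℕ) → Vec ℕ m → ℕ
coeffF k P m α =
  length (filter (λ f → isPPartition P f ∧ eqVec (content f) α)
                 (allVecs (Fin m) (finList m) k))

-- Coefficient of x^α in F(P, x) · L₁ where L₁ = x₁ + x₂ + ⋯ : the number of
-- pairs (f , j) with f a P-partition, j a variable index, and
-- x^{content f} · x_j = x^α.
coeffFL1 : (k : ℕ) → Rel → (m : ℕ) → Vec ℕ m → ℕ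
coeffFL1 k P m α =
  length (filter (λ jf → isPPartition P (Data.Product.proj₂ jf) ∧
                         eqVec (content (Data.Product.proj₂ jf) [ Data.Product.proj₁ jf ]%= suc) α)
                 (L.cartesianProduct (finList m) (allVecs (Fin m) (finList m) k)))
  where import Data.Product

_<lex_ : ∀ {n} → Vec Bool n → Vec Bool n → Bool
[]      <lex []      = false
(a ∷ as) <lex (b ∷ bs) = (not a ∧ b) ∨ ((not (a Data.Bool.xor b)) ∧ (as <lex bs))
  where import Data.Bool

words : (n : ℕ) → List (Vec Bool n)
words = allVecs Bool (false ∷ true ∷ [])

sumℕ : List ℕ → ℕ
sumℕ = sum

{-# OPTIONS --safe #-}
-- Reading σ backwards, each letter adds a newest label to Q: a 1 adds a new maximum, a 0 adds a
-- cover of the previous newest label and then swaps the two labels.  So the Q_σ-partitions can be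
-- characterised recursively along the reversed word.  A monomial of F(Q_σ)·L₁ comes from a
-- Q_σ-partition f together with one more value v, and inserting v into the values of f is a
-- bijection onto the partitions of the Q_τ, τ running through a list of insertions: τ = σ0 takes
-- the pairs in which v exceeds the value of the newest label, and the words obtained from σ by
-- inserting a 0 just before one of its letters 1 take the others.  Those words are
-- lexicographically smaller than σ0; c_τ counts how often τ occurs among them.
module Submission where

open import Defs
open import Algebra.Properties.CommutativeSemigroup using (interchange)
open import Data.Bool using (Bool; true; false; _∧_; _∨_; not; if_then_else_; T)
open import Data.Bool.ListAction using (and; all)
open import Data.Bool.Properties
  using (∧-conicalˡ; ∧-conicalʳ; ∧-assoc; ∧-comm; ∧-zeroʳ; ∧-identityʳ; ∨-identityʳ; T-≡; ⇔→≡)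
  renaming (_≟_ to _≟ᴮ_)
open import Data.Empty using (⊥-elim)
open import Data.Fin as Fin using (Fin; toℕ; fromℕ<)
open import Data.Fin.Properties using (toℕ<n; toℕ-fromℕ<)
open import Data.List as List using (List; []; _∷_; length; _++_; map; concatMap; allFin; filterᵇ)
open import Data.List.Properties
  using (map-++; map-cong; unfold-reverse; length-reverse; reverse-involutive; reverse-++; ++-assoc;
         ∷-injective; ∷-injectiveˡ)
open import Data.List.Relation.Unary.All as All using (All; []; _∷_)
open import Data.List.Relation.Unary.All.Properties using (map⁺)
open import Data.Nat using (ℕ; zero; suc; _+_; _*_; _∸_; _<ᵇ_; _≡ᵇ_; _<_; _≤_; s≤s; z<s; s<s)
open import Data.Nat.ListAction using (sum)
open import Data.Nat.ListAction.Properties using (sum-++)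
open import Data.Nat.Properties
  using (+-commutativeSemigroup; *-identityˡ; *-identityʳ; *-zeroʳ; *-distribˡ-+; *-distribʳ-+;
         suc-injective; ≡⇒≡ᵇ; ≡ᵇ⇒≡; <⇒<ᵇ; <ᵇ⇒<; ≤-refl; ≤-pred; <⇒≤; ≤-<-trans; n<1+n; m<n⇒m<1+n;
         m<1+n⇒m<n∨m≡n)
open import Data.Product as Product using (_×_; _,_; proj₁; ∃)
open import Data.Sum using (inj₁; inj₂)
open import Data.Vec as Vec using (Vec; []; _∷_; _∷ʳ_; _[_]%=_)
open import Data.Vec.Properties
  using (reverse-∷; map-reverse; toList-reverse; toList-∷ʳ; length-toList)
  renaming (≡-dec to ≡-decᵛ)
open import Function using (_∘_; id; Equivalence; mk⇔)
open import Relation.Binary.Definitions using (DecidableEquality)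
open import Relation.Binary.PropositionalEquality
open import Relation.Nullary.Decidable using (does; yes; no)

open ≡-Reasoning

private variable
  A B : Set

-- Finite sums

𝟙 : Bool → ℕ
𝟙 true  = 1
𝟙 false = 0

𝟙-∧ : ∀ a b → 𝟙 (a ∧ b) ≡ 𝟙 a * 𝟙 b
𝟙-∧ true  b = sym (*-identityˡ (𝟙 b))
𝟙-∧ false b = refl

∑ : List A → (A → ℕ) → ℕ
∑ xs g = sum (map g xs)

syntax ∑ xs (λ x → e) = ∑[ x ← xs ] e

length-filterᵇ : (p : A → Bool) (xs : List A) → length (filterᵇ p xs) ≡ ∑[ x ← xs ] 𝟙 (p x)
length-filterᵇ p []       = refl
length-filterᵇ p (x ∷ xs) with p x
... | true  = cong suc (length-filterᵇ p xs)
... | false = length-filterᵇ p xs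

∑-cong : ∀ (xs : List A) {g h : A → ℕ} → (∀ x → g x ≡ h x) → ∑ xs g ≡ ∑ xs h
∑-cong xs g≗h = cong sum (map-cong g≗h xs)

∑-cong-All : ∀ {P : A → Set} {xs : List A} {g h : A → ℕ} →
             All P xs → (∀ x → P x → g x ≡ h x) → ∑ xs g ≡ ∑ xs h
∑-cong-All []         g≗h = refl
∑-cong-All (px ∷ pxs) g≗h = cong₂ _+_ (g≗h _ px) (∑-cong-All pxs g≗h)

∑-++ : ∀ (xs ys : List A) (g : A → ℕ) → ∑ (xs ++ ys) g ≡ ∑ xs g + ∑ ys g
∑-++ xs ys g = trans (cong sum (map-++ g xs ys)) (sum-++ (map g xs) (map g ys))

∑-map : (f : B → A) (xs : List B) (g : A → ℕ) → ∑ (map f xs) g ≡ ∑[ x ← xs ] g (f x)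
∑-map f []       g = refl
∑-map f (x ∷ xs) g = cong (g (f x) +_) (∑-map f xs g)

∑-concatMap : (f : B → List A) (xs : List B) (g : A → ℕ) →
              ∑ (concatMap f xs) g ≡ ∑[ x ← xs ] ∑ (f x) g
∑-concatMap f []       g = refl
∑-concatMap f (x ∷ xs) g = trans (∑-++ (f x) (concatMap f xs) g) (cong (∑ (f x) g +_) (∑-concatMap f xs g))

∑-zero : ∀ (xs : List A) → ∑[ x ← xs ] 0 ≡ 0
∑-zero []       = refl
∑-zero (x ∷ xs) = ∑-zero xs

∑-+ : ∀ (xs : List A) (g h : A → ℕ) → ∑[ x ← xs ] (g x + h x) ≡ ∑ xs g + ∑ xs h
∑-+ []       g h = refl
∑-+ (x ∷ xs) g h = trans (cong (g x + h x +_) (∑-+ xs g h)) (interchange +-commutativeSemigroup (g x) (h x) (∑ xs g) (∑ xs h))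

∑-comm : (xs : List A) (ys : List B) (g : A → B → ℕ) →
         ∑[ x ← xs ] ∑ ys (g x) ≡ ∑[ y ← ys ] ∑[ x ← xs ] g x y
∑-comm []       ys g = sym (∑-zero ys)
∑-comm (x ∷ xs) ys g = trans (cong (∑ ys (g x) +_) (∑-comm xs ys g)) (sym (∑-+ ys (g x) _))

∑-*ˡ : ∀ (c : ℕ) (xs : List A) (g : A → ℕ) → ∑[ x ← xs ] (c * g x) ≡ c * ∑ xs g
∑-*ˡ c []       g = sym (*-zeroʳ c)
∑-*ˡ c (x ∷ xs) g = trans (cong (c * g x +_) (∑-*ˡ c xs g)) (sym (*-distribˡ-+ c (g x) _))

∑-*ʳ : ∀ (c : ℕ) (xs : List A) (g : A → ℕ) → ∑[ x ← xs ] (g x * c) ≡ ∑ xs g * c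
∑-*ʳ c []       g = refl
∑-*ʳ c (x ∷ xs) g = trans (cong (g x * c +_) (∑-*ʳ c xs g)) (sym (*-distribʳ-+ c (g x) _))

∑-cartesianProduct : (xs : List A) (ys : List B) (g : A × B → ℕ) →
                     ∑ (List.cartesianProduct xs ys) g ≡ ∑[ x ← xs ] ∑[ y ← ys ] g (x , y)
∑-cartesianProduct []       ys g = refl
∑-cartesianProduct (x ∷ xs) ys g =
  trans (∑-++ (map (x ,_) ys) _ g) (cong₂ _+_ (∑-map (x ,_) ys g) (∑-cartesianProduct xs ys g))

module _ {A : Set} (xs : List A) where

  ∑-allVecs-∷ : ∀ k (h : Vec A (suc k) → ℕ) →
                ∑ (allVecs A xs (suc k)) h ≡ ∑[ x ← xs ] ∑[ v ← allVecs A xs k ] h (x ∷ v)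
  ∑-allVecs-∷ k h = trans (∑-concatMap _ xs h) (∑-cong xs λ x → ∑-map (x ∷_) (allVecs A xs k) h)

  ∑-allVecs-insertAt : ∀ k (i : Fin (suc k)) (h : Vec A (suc k) → ℕ) →
                       ∑ (allVecs A xs (suc k)) h ≡ ∑[ x ← xs ] ∑[ v ← allVecs A xs k ] h (Vec.insertAt v i x)
  ∑-allVecs-insertAt k       Fin.zero    h = ∑-allVecs-∷ k h
  ∑-allVecs-insertAt (suc k) (Fin.suc i) h = begin
    ∑ (allVecs A xs (suc (suc k))) h
      ≡⟨ ∑-allVecs-∷ (suc k) h ⟩
    ∑[ y ← xs ] ∑[ v ← allVecs A xs (suc k) ] h (y ∷ v)
      ≡⟨ ∑-cong xs (λ y → ∑-allVecs-insertAt k i (h ∘ (y ∷_))) ⟩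
    ∑[ y ← xs ] ∑[ x ← xs ] ∑[ v ← allVecs A xs k ] h (y ∷ Vec.insertAt v i x)
      ≡⟨ ∑-comm xs xs _ ⟩
    ∑[ x ← xs ] ∑[ y ← xs ] ∑[ v ← allVecs A xs k ] h (y ∷ Vec.insertAt v i x)
      ≡⟨ ∑-cong xs (λ x → sym (∑-allVecs-∷ k (λ v → h (Vec.insertAt v (Fin.suc i) x)))) ⟩
    ∑[ x ← xs ] ∑[ v ← allVecs A xs (suc k) ] h (Vec.insertAt v (Fin.suc i) x) ∎

  ∑-allVecs-∷ʳ : ∀ k (h : Vec A (suc k) → ℕ) →
                 ∑ (allVecs A xs (suc k)) h ≡ ∑[ x ← xs ] ∑[ v ← allVecs A xs k ] h (v ∷ʳ x)
  ∑-allVecs-∷ʳ k h = trans (∑-allVecs-insertAt k (Fin.fromℕ k) h)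
                           (∑-cong xs λ x → ∑-cong (allVecs A xs k) λ v → cong h (insertAt-fromℕ v x))
    where
    insertAt-fromℕ : ∀ {k} (v : Vec A k) x → Vec.insertAt v (Fin.fromℕ k) x ≡ v ∷ʳ x
    insertAt-fromℕ []      x = refl
    insertAt-fromℕ (y ∷ v) x = cong (y ∷_) (insertAt-fromℕ v x)

  ∑-allVecs-reverse : ∀ k (h : Vec A k → ℕ) → ∑ (allVecs A xs k) h ≡ ∑[ v ← allVecs A xs k ] h (Vec.reverse v)
  ∑-allVecs-reverse zero    h = refl
  ∑-allVecs-reverse (suc k) h = begin
    ∑ (allVecs A xs (suc k)) h
      ≡⟨ ∑-allVecs-∷ʳ k h ⟩
    ∑[ x ← xs ] ∑[ v ← allVecs A xs k ] h (v ∷ʳ x)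
      ≡⟨ ∑-cong xs (λ x → ∑-allVecs-reverse k (h ∘ (_∷ʳ x))) ⟩
    ∑[ x ← xs ] ∑[ v ← allVecs A xs k ] h (Vec.reverse v ∷ʳ x)
      ≡⟨ ∑-cong xs (λ x → ∑-cong (allVecs A xs k) λ v → cong h (sym (reverse-∷ x v))) ⟩
    ∑[ x ← xs ] ∑[ v ← allVecs A xs k ] h (Vec.reverse (x ∷ v))
      ≡⟨ sym (∑-allVecs-∷ k (h ∘ Vec.reverse)) ⟩
    ∑[ v ← allVecs A xs (suc k) ] h (Vec.reverse v) ∎

  module _ (_≟_ : DecidableEquality A) (xs-unique : ∀ a → ∑[ x ← xs ] 𝟙 (does (x ≟ a)) ≡ 1) where

    allVecs-unique : ∀ k (u : Vec A k) → ∑[ v ← allVecs A xs k ] 𝟙 (does (≡-decᵛ _≟_ v u)) ≡ 1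
    allVecs-unique zero    []      = refl
    allVecs-unique (suc k) (a ∷ u) = begin
      ∑[ v ← allVecs A xs (suc k) ] 𝟙 (does (≡-decᵛ _≟_ v (a ∷ u)))
        ≡⟨ ∑-allVecs-∷ k _ ⟩
      ∑[ x ← xs ] ∑[ v ← allVecs A xs k ] 𝟙 (does (x ≟ a) ∧ does (≡-decᵛ _≟_ v u))
        ≡⟨ ∑-cong xs (λ x → ∑-cong (allVecs A xs k) λ v → 𝟙-∧ (does (x ≟ a)) _) ⟩
      ∑[ x ← xs ] ∑[ v ← allVecs A xs k ] (𝟙 (does (x ≟ a)) * 𝟙 (does (≡-decᵛ _≟_ v u)))
        ≡⟨ ∑-cong xs (λ x → ∑-*ˡ (𝟙 (does (x ≟ a))) (allVecs A xs k) _) ⟩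
      ∑[ x ← xs ] (𝟙 (does (x ≟ a)) * ∑[ v ← allVecs A xs k ] 𝟙 (does (≡-decᵛ _≟_ v u)))
        ≡⟨ ∑-cong xs (λ x → cong (𝟙 (does (x ≟ a)) *_) (allVecs-unique k u)) ⟩
      ∑[ x ← xs ] (𝟙 (does (x ≟ a)) * 1)
        ≡⟨ trans (∑-*ʳ 1 xs _) (trans (*-identityʳ _) (xs-unique a)) ⟩
      1 ∎

false≢true : false ≢ true
false≢true ()

T⇒≡true : ∀ {b} → T b → b ≡ true
T⇒≡true = Equivalence.to T-≡

≡true⇒T : ∀ {b} → b ≡ true → T b
≡true⇒T = Equivalence.from T-≡

≡ᵇ-refl : ∀ n → (n ≡ᵇ n) ≡ true
≡ᵇ-refl n = T⇒≡true (≡⇒≡ᵇ n n refl)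

<⇒≢ᵇ : ∀ {i n} → i < n → (i ≡ᵇ n) ≡ false
<⇒≢ᵇ {zero}  {suc n} _         = refl
<⇒≢ᵇ {suc i} {suc n} (s≤s i<n) = <⇒≢ᵇ i<n

n≢ᵇ1+n : ∀ n → (n ≡ᵇ suc n) ≡ false
n≢ᵇ1+n n = <⇒≢ᵇ (n<1+n n)

<⇒<ᵇ≡true : ∀ {m n} → m < n → (m <ᵇ n) ≡ true
<⇒<ᵇ≡true = T⇒≡true ∘ <⇒<ᵇ

≤⇒≮ᵇ : ∀ {m n} → n ≤ m → (m <ᵇ n) ≡ false
≤⇒≮ᵇ {m} {zero}  _         = refl
≤⇒≮ᵇ {suc m} {suc n} (s≤s n≤m) = ≤⇒≮ᵇ n≤m

≤ᵇ-<ᵇ-trans : ∀ a b c → (a ≤ᵇ' b) ≡ true → (b <ᵇ c) ≡ true → (a ≤ᵇ' c) ≡ true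
≤ᵇ-<ᵇ-trans a b c a≤b b<c =
  <⇒<ᵇ≡true (m<n⇒m<1+n (≤-<-trans (≤-pred (<ᵇ⇒< a (suc b) (≡true⇒T a≤b))) (<ᵇ⇒< b c (≡true⇒T b<c))))

nth : List ℕ → ℕ → ℕ
nth []       i       = 0
nth (x ∷ xs) zero    = x
nth (x ∷ xs) (suc i) = nth xs i

nth-++ˡ : ∀ xs ys {i} → i < length xs → nth (xs ++ ys) i ≡ nth xs i
nth-++ˡ (x ∷ xs) ys {zero}  _         = refl
nth-++ˡ (x ∷ xs) ys {suc i} (s≤s i<n) = nth-++ˡ xs ys i<n

nth-++-length : ∀ xs y ys → nth (xs ++ y ∷ ys) (length xs) ≡ y
nth-++-length []       y ys = refl
nth-++-length (x ∷ xs) y ys = nth-++-length xs y ys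

nth-++-1+length : ∀ xs y z ys → nth (xs ++ y ∷ z ∷ ys) (suc (length xs)) ≡ z
nth-++-1+length []       y z ys = refl
nth-++-1+length (x ∷ xs) y z ys = nth-++-1+length xs y z ys

all-nth⁻ : ∀ (p : ℕ → Bool) xs → all p xs ≡ true → ∀ {i} → i < length xs → p (nth xs i) ≡ true
all-nth⁻ p (x ∷ xs) e {zero}  _         = ∧-conicalˡ _ _ e
all-nth⁻ p (x ∷ xs) e {suc i} (s≤s i<n) = all-nth⁻ p xs (∧-conicalʳ _ _ e) i<n

all-nth⁺ : ∀ (p : ℕ → Bool) xs → (∀ {i} → i < length xs → p (nth xs i) ≡ true) → all p xs ≡ true
all-nth⁺ p []       _     = refl
all-nth⁺ p (x ∷ xs) every = cong₂ _∧_ (every z<s) (all-nth⁺ p xs (every ∘ s<s))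

all-++ : ∀ (p : A → Bool) xs ys → all p (xs ++ ys) ≡ all p xs ∧ all p ys
all-++ p []       ys = refl
all-++ p (x ∷ xs) ys = trans (cong (p x ∧_) (all-++ p xs ys)) (sym (∧-assoc (p x) _ _))

all-reverse : ∀ (p : A → Bool) xs → all p (List.reverse xs) ≡ all p xs
all-reverse p []       = refl
all-reverse p (x ∷ xs) = begin
  all p (List.reverse (x ∷ xs))           ≡⟨ cong (all p) (unfold-reverse x xs) ⟩
  all p (List.reverse xs ++ x ∷ [])       ≡⟨ all-++ p (List.reverse xs) (x ∷ []) ⟩
  all p (List.reverse xs) ∧ (p x ∧ true)  ≡⟨ cong₂ _∧_ (all-reverse p xs) (∧-identityʳ (p x)) ⟩
  all p xs ∧ p x                          ≡⟨ ∧-comm (all p xs) (p x) ⟩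
  p x ∧ all p xs                          ∎

-- P-partitions as conditions on value lists

values : ∀ {k m} → Vec (Fin m) k → List ℕ
values f = Vec.toList (Vec.map toℕ f)

toℕ-lookup : ∀ {k m} (f : Vec (Fin m) k) (i : Fin k) → toℕ (Vec.lookup f i) ≡ nth (values f) (toℕ i)
toℕ-lookup (x ∷ f) Fin.zero    = refl
toℕ-lookup (x ∷ f) (Fin.suc i) = toℕ-lookup f i

compatible : (x y i j : ℕ) → Bool
compatible x y i j = if j <ᵇ i then x <ᵇ y else x ≤ᵇ' y

IsPartition : Rel → ℕ → List ℕ → Set
IsPartition P k g = ∀ i j → i < k → j < k → P i j ≡ true → compatible (nth g i) (nth g j) i j ≡ true

and-map-tabulate⁻ : ∀ {k} (g : Fin k → A) (h : A → Bool) →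
                    and (map h (List.tabulate g)) ≡ true → ∀ i → h (g i) ≡ true
and-map-tabulate⁻ {k = suc k} g h e Fin.zero    = ∧-conicalˡ _ _ e
and-map-tabulate⁻ {k = suc k} g h e (Fin.suc i) = and-map-tabulate⁻ (g ∘ Fin.suc) h (∧-conicalʳ _ _ e) i

and-map-tabulate⁺ : ∀ {k} (g : Fin k → A) (h : A → Bool) →
                    (∀ i → h (g i) ≡ true) → and (map h (List.tabulate g)) ≡ true
and-map-tabulate⁺ {k = zero}  g h every = refl
and-map-tabulate⁺ {k = suc k} g h every =
  cong₂ _∧_ (every Fin.zero) (and-map-tabulate⁺ (g ∘ Fin.suc) h (every ∘ Fin.suc))

module _ {k m : ℕ} (P : Rel) (f : Vec (Fin m) k) where

  private
    -- the test that isPPartition applies to each pair of labels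
    cond : Fin k → Fin k → Bool
    cond i j = if P (toℕ i) (toℕ j)
               then (if toℕ j <ᵇ toℕ i
                     then toℕ (Vec.lookup f i) <ᵇ toℕ (Vec.lookup f j)
                     else toℕ (Vec.lookup f i) ≤ᵇ' toℕ (Vec.lookup f j))
               else true

    cond⇒compatible : ∀ i j → cond i j ≡ true → P (toℕ i) (toℕ j) ≡ true →
                      compatible (nth (values f) (toℕ i)) (nth (values f) (toℕ j)) (toℕ i) (toℕ j) ≡ true
    cond⇒compatible i j c Pij rewrite Pij | sym (toℕ-lookup f i) | sym (toℕ-lookup f j) = c

    compatible⇒cond : ∀ i j → (P (toℕ i) (toℕ j) ≡ true →
                      compatible (nth (values f) (toℕ i)) (nth (values f) (toℕ j)) (toℕ i) (toℕ j) ≡ true) →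
                      cond i j ≡ true
    compatible⇒cond i j c with P (toℕ i) (toℕ j)
    ... | false = refl
    ... | true rewrite toℕ-lookup f i | toℕ-lookup f j = c refl

  isPPartition⇒IsPartition : isPPartition P f ≡ true → IsPartition P k (values f)
  isPPartition⇒IsPartition e i j i<k j<k Pij
    with cond⇒compatible (fromℕ< i<k) (fromℕ< j<k)
           (and-map-tabulate⁻ id (cond (fromℕ< i<k))
             (and-map-tabulate⁻ id (λ i → and (map (cond i) (allFin k))) e (fromℕ< i<k)) (fromℕ< j<k))
  ... | c rewrite toℕ-fromℕ< i<k | toℕ-fromℕ< j<k = c Pij

  IsPartition⇒isPPartition : IsPartition P k (values f) → isPPartition P f ≡ true
  IsPartition⇒isPPartition p =
    and-map-tabulate⁺ id _ λ i → and-map-tabulate⁺ id _ λ j →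
      compatible⇒cond i j (p (toℕ i) (toℕ j) (toℕ<n i) (toℕ<n j))

compatible-refl : ∀ x i → compatible x x i i ≡ true
compatible-refl x i rewrite ≤⇒≮ᵇ (≤-refl {i}) = <⇒<ᵇ≡true (n<1+n x)

compatible-> : ∀ x y {i j} → j < i → compatible x y i j ≡ (x <ᵇ y)
compatible-> x y j<i rewrite <⇒<ᵇ≡true j<i = refl

compatible-≤ : ∀ x y {i j} → i ≤ j → compatible x y i j ≡ (x ≤ᵇ' y)
compatible-≤ x y i≤j rewrite ≤⇒≮ᵇ i≤j = refl

IsPartition-≗ : ∀ {P P′ : Rel} {k g} → (∀ i j → P i j ≡ P′ i j) → IsPartition P k g → IsPartition P′ k g
IsPartition-≗ P≗P′ p i j i<k j<k P′ij = p i j i<k j<k (trans (P≗P′ i j) P′ij)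

-- The posets Q_σ

withTop : Rel → ℕ → Rel
withTop old L i j = (j ≡ᵇ L) ∨ (not (i ≡ᵇ L) ∧ old i j)

addCover : Rel → ℕ → Rel
addCover old k x y = ((y ≡ᵇ k) ∧ ((x ≡ᵇ k) ∨ old x (k ∸ 1)))
                   ∨ (not (y ≡ᵇ k) ∧ not (x ≡ᵇ k) ∧ old x y)

swapLabel : ℕ → ℕ → ℕ
swapLabel k i = if i ≡ᵇ k then k ∸ 1 else (if i ≡ᵇ k ∸ 1 then k else i)

coverSwap : Rel → ℕ → Rel
coverSwap old k i j = addCover old k (swapLabel k i) (swapLabel k j)

Qrev-allZero : ∀ ρ → allZero ρ ≡ true → ∀ i j → Qrev ρ i j ≡ (i ≡ᵇ j)
Qrev-allZero []          _  i j = refl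
Qrev-allZero (false ∷ ρ) az i j with allZero ρ | az
... | true | _ = refl

Qrev-false : ∀ ρ → allZero ρ ≡ false → ∀ i j → Qrev (false ∷ ρ) i j ≡ coverSwap (Qrev ρ) (length ρ) i j
Qrev-false ρ az i j with allZero ρ | az
... | false | _ = refl

addCover-refl : ∀ old k → (∀ x → old x x ≡ true) → ∀ x → addCover old k x x ≡ true
addCover-refl old k old-refl x with x ≡ᵇ k
... | true  = refl
... | false = old-refl x

Qrev-refl : ∀ ρ i → Qrev ρ i i ≡ true
Qrev-refl []         i = ≡ᵇ-refl i
Qrev-refl (true ∷ ρ) i with i ≡ᵇ length ρ
... | true  = refl
... | false = Qrev-refl ρ i
Qrev-refl (false ∷ ρ) i with allZero ρ
... | true  = ≡ᵇ-refl i
... | false = addCover-refl (Qrev ρ) (length ρ) (Qrev-refl ρ) (swapLabel (length ρ) i)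

-- In coverSwap old (suc L) the new element has label L and the old label L has moved to suc L.
module _ (old : Rel) {L : ℕ} where

  private
    ≢ᵇ-moved : ∀ {i} → i < L → (i ≡ᵇ suc L) ≡ false
    ≢ᵇ-moved i<L = <⇒≢ᵇ (m<n⇒m<1+n i<L)

    swapLabel-< : ∀ {i} → i < L → swapLabel (suc L) i ≡ i
    swapLabel-< i<L rewrite ≢ᵇ-moved i<L | <⇒≢ᵇ i<L = refl

    swapLabel-new : swapLabel (suc L) L ≡ suc L
    swapLabel-new rewrite n≢ᵇ1+n L | ≡ᵇ-refl L = refl

    swapLabel-moved : swapLabel (suc L) (suc L) ≡ L
    swapLabel-moved rewrite ≡ᵇ-refl L = refl

  coverSwap-<-< : ∀ {i j} → i < L → j < L → coverSwap old (suc L) i j ≡ old i j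
  coverSwap-<-< i<L j<L rewrite swapLabel-< i<L | swapLabel-< j<L | ≢ᵇ-moved i<L | ≢ᵇ-moved j<L = refl

  coverSwap-<-moved : ∀ {i} → i < L → coverSwap old (suc L) i (suc L) ≡ old i L
  coverSwap-<-moved i<L rewrite swapLabel-< i<L | swapLabel-moved | ≢ᵇ-moved i<L | n≢ᵇ1+n L = refl

  coverSwap-moved-< : ∀ {j} → j < L → coverSwap old (suc L) (suc L) j ≡ old L j
  coverSwap-moved-< j<L rewrite swapLabel-< j<L | swapLabel-moved | ≢ᵇ-moved j<L | n≢ᵇ1+n L = refl

  coverSwap-moved-new : coverSwap old (suc L) (suc L) L ≡ old L L
  coverSwap-moved-new rewrite swapLabel-moved | swapLabel-new | ≡ᵇ-refl L | n≢ᵇ1+n L = ∨-identityʳ (old L L)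

  coverSwap-<-new : ∀ {i} → i < L → coverSwap old (suc L) i L ≡ old i L
  coverSwap-<-new {i} i<L rewrite swapLabel-< i<L | swapLabel-new | ≡ᵇ-refl L | ≢ᵇ-moved i<L = ∨-identityʳ (old i L)

  coverSwap-new-< : ∀ {j} → j < L → coverSwap old (suc L) L j ≡ false
  coverSwap-new-< j<L rewrite swapLabel-< j<L | swapLabel-new | ≢ᵇ-moved j<L | ≡ᵇ-refl L = refl

  coverSwap-new-moved : coverSwap old (suc L) L (suc L) ≡ false
  coverSwap-new-moved rewrite swapLabel-moved | swapLabel-new | n≢ᵇ1+n L | ≡ᵇ-refl L = refl

IsPartition-antichain : ∀ ρ → allZero ρ ≡ true → ∀ k g → IsPartition (Qrev ρ) k g
IsPartition-antichain ρ az k g i j _ _ Qij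
  with ≡ᵇ⇒≡ i j (≡true⇒T (trans (sym (Qrev-allZero ρ az i j)) Qij))
... | refl = compatible-refl (nth g i) i

module _ (old : Rel) {L : ℕ} where

  withTop-<-< : ∀ {i j} → i < L → j < L → withTop old L i j ≡ old i j
  withTop-<-< i<L j<L rewrite <⇒≢ᵇ i<L | <⇒≢ᵇ j<L = refl

  withTop-top : ∀ i → withTop old L i L ≡ true
  withTop-top i rewrite ≡ᵇ-refl L = refl

  withTop-top-< : ∀ {j} → j < L → withTop old L L j ≡ false
  withTop-top-< j<L rewrite <⇒≢ᵇ j<L | ≡ᵇ-refl L = refl

  module _ (g : List ℕ) (g-length : length g ≡ L) (a : ℕ) where

    private
      h : List ℕ
      h = g ++ a ∷ []

      length-< : ∀ {i} → i < L → i < length g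
      length-< = subst (_ <_) (sym g-length)

      <-length : ∀ {i} → i < length g → i < L
      <-length = subst (_ <_) g-length

      h-< : ∀ {i} → i < L → nth h i ≡ nth g i
      h-< i<L = nth-++ˡ g _ (length-< i<L)

      h-top : nth h L ≡ a
      h-top = subst (λ n → nth h n ≡ a) g-length (nth-++-length g a [])

    IsPartition-withTop⁻ : IsPartition (withTop old L) (suc L) (g ++ a ∷ []) →
                           IsPartition old L g × all (_≤ᵇ' a) g ≡ true
    IsPartition-withTop⁻ ph = pg , all-nth⁺ (_≤ᵇ' a) g (bounded _ ∘ <-length)
      where
      pg : IsPartition old L g
      pg i j i<L j<L oij =
        subst₂ (λ x y → compatible x y i j ≡ true) (h-< i<L) (h-< j<L)
          (ph i j (m<n⇒m<1+n i<L) (m<n⇒m<1+n j<L) (trans (withTop-<-< i<L j<L) oij))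
      bounded : ∀ i → i < L → (nth g i ≤ᵇ' a) ≡ true
      bounded i i<L = begin
        nth g i ≤ᵇ' a                       ≡⟨ cong₂ _≤ᵇ'_ (h-< i<L) h-top ⟨
        nth h i ≤ᵇ' nth h L                 ≡⟨ compatible-≤ (nth h i) (nth h L) (<⇒≤ i<L) ⟨
        compatible (nth h i) (nth h L) i L  ≡⟨ ph i L (m<n⇒m<1+n i<L) (n<1+n L) (withTop-top i) ⟩
        true                                ∎

    IsPartition-withTop⁺ : IsPartition old L g → all (_≤ᵇ' a) g ≡ true →
                           IsPartition (withTop old L) (suc L) (g ++ a ∷ [])
    IsPartition-withTop⁺ pg g≤a i j i<1+L j<1+L wij
      with m<1+n⇒m<n∨m≡n i<1+L | m<1+n⇒m<n∨m≡n j<1+L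
    ... | inj₂ refl | inj₂ refl = compatible-refl (nth h L) L
    ... | inj₁ i<L  | inj₂ refl = begin
      compatible (nth h i) (nth h L) i L  ≡⟨ compatible-≤ (nth h i) (nth h L) (<⇒≤ i<L) ⟩
      nth h i ≤ᵇ' nth h L                 ≡⟨ cong₂ _≤ᵇ'_ (h-< i<L) h-top ⟩
      nth g i ≤ᵇ' a                       ≡⟨ all-nth⁻ (_≤ᵇ' a) g g≤a (length-< i<L) ⟩
      true                                ∎
    ... | inj₂ refl | inj₁ j<L  = ⊥-elim (false≢true (trans (sym (withTop-top-< j<L)) wij))
    ... | inj₁ i<L  | inj₁ j<L  =
      subst₂ (λ x y → compatible x y i j ≡ true) (sym (h-< i<L)) (sym (h-< j<L))
        (pg i j i<L j<L (trans (sym (withTop-<-< i<L j<L)) wij))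

compatible-≤-≤ : ∀ {x y x′ y′ i j i′ j′} → i ≤ j → i′ ≤ j′ → x ≡ x′ → y ≡ y′ →
                 compatible x y i j ≡ compatible x′ y′ i′ j′
compatible-≤-≤ {x} {y} {x′} {y′} i≤j i′≤j′ refl refl = trans (compatible-≤ x y i≤j) (sym (compatible-≤ x′ y′ i′≤j′))

compatible->-> : ∀ {x y x′ y′ i j i′ j′} → j < i → j′ < i′ → x ≡ x′ → y ≡ y′ →
                 compatible x y i j ≡ compatible x′ y′ i′ j′
compatible->-> {x} {y} {x′} {y′} j<i j′<i′ refl refl = trans (compatible-> x y j<i) (sym (compatible-> x′ y′ j′<i′))

data Slot (L : ℕ) : ℕ → Set where
  below : ∀ {i} → i < L → Slot L i
  new   : Slot L L
  moved : Slot L (suc L)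

slot : ∀ {L i} → i < suc (suc L) → Slot L i
slot {L} i<2+L with m<1+n⇒m<n∨m≡n i<2+L
... | inj₂ refl = moved
... | inj₁ i<1+L with m<1+n⇒m<n∨m≡n i<1+L
...   | inj₁ i<L  = below i<L
...   | inj₂ refl = new

module _ (old : Rel) {L : ℕ} (xs : List ℕ) (xs-length : length xs ≡ L) (v w : ℕ) where

  private
    g h : List ℕ
    g = xs ++ w ∷ []
    h = xs ++ v ∷ w ∷ []

    g≈h : ∀ {i} → i < L → nth g i ≡ nth h i
    g≈h i<L = trans (nth-++ˡ xs _ i<xs) (sym (nth-++ˡ xs _ i<xs))
      where i<xs = subst (_ <_) (sym xs-length) i<L

    g-top : nth g L ≡ w
    g-top = subst (λ n → nth g n ≡ w) xs-length (nth-++-length xs w [])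

    h-new : nth h L ≡ v
    h-new = subst (λ n → nth h n ≡ v) xs-length (nth-++-length xs v _)

    h-moved : nth h (suc L) ≡ w
    h-moved = subst (λ n → nth h (suc n) ≡ w) xs-length (nth-++-1+length xs v w [])

    <2+ : ∀ {i} → i < L → i < suc (suc L)
    <2+ i<L = m<n⇒m<1+n (m<n⇒m<1+n i<L)

  IsPartition-coverSwap⁻ : old L L ≡ true →
                           IsPartition (coverSwap old (suc L)) (suc (suc L)) (xs ++ v ∷ w ∷ []) →
                           IsPartition old (suc L) (xs ++ w ∷ []) × (w <ᵇ v) ≡ true
  IsPartition-coverSwap⁻ old-refl ph = pg , w<v
    where
    w<v : (w <ᵇ v) ≡ true
    w<v = begin
      w <ᵇ v                                           ≡⟨ cong₂ _<ᵇ_ h-moved h-new ⟨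
      nth h (suc L) <ᵇ nth h L                         ≡⟨ compatible-> (nth h (suc L)) (nth h L) (n<1+n L) ⟨
      compatible (nth h (suc L)) (nth h L) (suc L) L
        ≡⟨ ph (suc L) L (n<1+n _) (m<n⇒m<1+n (n<1+n L)) (trans (coverSwap-moved-new old {L}) old-refl) ⟩
      true                                             ∎
    pg : IsPartition old (suc L) g
    pg i j i<1+L j<1+L oij with m<1+n⇒m<n∨m≡n i<1+L | m<1+n⇒m<n∨m≡n j<1+L
    ... | inj₂ refl | inj₂ refl = compatible-refl (nth g L) L
    ... | inj₁ i<L  | inj₁ j<L  =
      trans (cong₂ (λ x y → compatible x y i j) (g≈h i<L) (g≈h j<L))
            (ph i j (<2+ i<L) (<2+ j<L) (trans (coverSwap-<-< old i<L j<L) oij))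
    ... | inj₁ i<L  | inj₂ refl =
      trans (compatible-≤-≤ (<⇒≤ i<L) (<⇒≤ (m<n⇒m<1+n i<L)) (g≈h i<L) (trans g-top (sym h-moved)))
            (ph i (suc L) (<2+ i<L) (n<1+n _) (trans (coverSwap-<-moved old i<L) oij))
    ... | inj₂ refl | inj₁ j<L  =
      trans (compatible->-> j<L (m<n⇒m<1+n j<L) (trans g-top (sym h-moved)) (g≈h j<L))
            (ph (suc L) j (n<1+n _) (<2+ j<L) (trans (coverSwap-moved-< old j<L) oij))

  IsPartition-coverSwap⁺ : IsPartition old (suc L) (xs ++ w ∷ []) → (w <ᵇ v) ≡ true →
                           IsPartition (coverSwap old (suc L)) (suc (suc L)) (xs ++ v ∷ w ∷ [])
  IsPartition-coverSwap⁺ pg w<v i j i<2+L j<2+L cij with slot i<2+L | slot j<2+L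
  ... | new       | new       = compatible-refl (nth h L) L
  ... | moved     | moved     = compatible-refl (nth h (suc L)) (suc L)
  ... | below i<L | below j<L =
    trans (cong₂ (λ x y → compatible x y i j) (sym (g≈h i<L)) (sym (g≈h j<L)))
          (pg i j (m<n⇒m<1+n i<L) (m<n⇒m<1+n j<L) (trans (sym (coverSwap-<-< old i<L j<L)) cij))
  ... | below i<L | moved     =
    trans (compatible-≤-≤ (<⇒≤ (m<n⇒m<1+n i<L)) (<⇒≤ i<L) (sym (g≈h i<L)) (trans h-moved (sym g-top)))
          (pg i L (m<n⇒m<1+n i<L) (n<1+n L) (trans (sym (coverSwap-<-moved old i<L)) cij))
  ... | moved     | below j<L =
    trans (compatible->-> (m<n⇒m<1+n j<L) j<L (trans h-moved (sym g-top)) (sym (g≈h j<L)))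
          (pg L j (n<1+n L) (m<n⇒m<1+n j<L) (trans (sym (coverSwap-moved-< old j<L)) cij))
  ... | moved     | new       =
    trans (compatible-> (nth h (suc L)) (nth h L) (n<1+n L)) (trans (cong₂ _<ᵇ_ h-moved h-new) w<v)
  ... | below i<L | new       = begin
    compatible (nth h i) (nth h L) i L  ≡⟨ compatible-≤ (nth h i) (nth h L) (<⇒≤ i<L) ⟩
    nth h i ≤ᵇ' nth h L                 ≡⟨ cong₂ _≤ᵇ'_ (sym (g≈h i<L)) h-new ⟩
    nth g i ≤ᵇ' v                       ≡⟨ ≤ᵇ-<ᵇ-trans (nth g i) w v g-i≤w w<v ⟩
    true                                ∎
    where
    g-i≤w : (nth g i ≤ᵇ' w) ≡ true
    g-i≤w = begin
      nth g i ≤ᵇ' w                       ≡⟨ cong (nth g i ≤ᵇ'_) g-top ⟨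
      nth g i ≤ᵇ' nth g L                 ≡⟨ compatible-≤ (nth g i) (nth g L) (<⇒≤ i<L) ⟨
      compatible (nth g i) (nth g L) i L
        ≡⟨ pg i L (m<n⇒m<1+n i<L) (n<1+n L) (trans (sym (coverSwap-<-new old i<L)) cij) ⟩
      true                                ∎
  ... | new       | below j<L = ⊥-elim (false≢true (trans (sym (coverSwap-new-< old j<L)) cij))
  ... | new       | moved     = ⊥-elim (false≢true (trans (sym (coverSwap-new-moved old {L})) cij))

-- Partitions of Q_σ along the reversed word

-- ρ is the word reversed and φ lists the values from the largest label down, so that
-- both recursions peel off the newest label first.
isQPartition : List Bool → List ℕ → Bool
isQPartitionStep : List Bool → List ℕ → Bool

isQPartition ρ φ = allZero ρ ∨ isQPartitionStep ρ φ

isQPartitionStep (true ∷ ρ)  (a ∷ φ)     = isQPartition ρ φ ∧ all (_≤ᵇ' a) φ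
isQPartitionStep (false ∷ ρ) (w ∷ v ∷ φ) = isQPartition ρ (w ∷ φ) ∧ (w <ᵇ v)
isQPartitionStep _           _           = false

reverse-∷-∷ : ∀ (w v : ℕ) φ → List.reverse (w ∷ v ∷ φ) ≡ List.reverse φ ++ v ∷ w ∷ []
reverse-∷-∷ w v φ = begin
  List.reverse (w ∷ v ∷ φ)                 ≡⟨ unfold-reverse w (v ∷ φ) ⟩
  List.reverse (v ∷ φ) ++ w ∷ []           ≡⟨ cong (_++ w ∷ []) (unfold-reverse v φ) ⟩
  (List.reverse φ ++ v ∷ []) ++ w ∷ []     ≡⟨ ++-assoc (List.reverse φ) (v ∷ []) (w ∷ []) ⟩
  List.reverse φ ++ v ∷ w ∷ []             ∎

isQPartition⇒IsPartition : ∀ ρ φ → length φ ≡ length ρ → isQPartition ρ φ ≡ true →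
                           IsPartition (Qrev ρ) (length ρ) (List.reverse φ)
isQPartitionStep⇒IsPartition : ∀ ρ φ → length φ ≡ length ρ → allZero ρ ≡ false → isQPartitionStep ρ φ ≡ true →
                               IsPartition (Qrev ρ) (length ρ) (List.reverse φ)

isQPartition⇒IsPartition ρ φ len q with allZero ρ in az
... | true  = IsPartition-antichain ρ az (length ρ) (List.reverse φ)
... | false = isQPartitionStep⇒IsPartition ρ φ len az q

isQPartitionStep⇒IsPartition (true ∷ ρ) (a ∷ φ) len _ q =
  subst (IsPartition (Qrev (true ∷ ρ)) _) (sym (unfold-reverse a φ))
    (IsPartition-withTop⁺ (Qrev ρ) (List.reverse φ) (trans (length-reverse φ) (suc-injective len)) a
      (isQPartition⇒IsPartition ρ φ (suc-injective len) (∧-conicalˡ _ _ q))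
      (trans (all-reverse (_≤ᵇ' a) φ) (∧-conicalʳ _ _ q)))
isQPartitionStep⇒IsPartition (false ∷ c ∷ ρ) (w ∷ v ∷ φ) len az q =
  subst (IsPartition (Qrev (false ∷ c ∷ ρ)) _) (sym (reverse-∷-∷ w v φ))
    (IsPartition-≗ {g = List.reverse φ ++ v ∷ w ∷ []} (λ i j → sym (Qrev-false (c ∷ ρ) az i j))
      (IsPartition-coverSwap⁺ (Qrev (c ∷ ρ)) (List.reverse φ)
        (trans (length-reverse φ) (suc-injective (suc-injective len))) v w
        (subst (IsPartition (Qrev (c ∷ ρ)) _) (unfold-reverse w φ)
          (isQPartition⇒IsPartition (c ∷ ρ) (w ∷ φ) (suc-injective len) (∧-conicalˡ _ _ q)))
        (∧-conicalʳ _ _ q)))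

IsPartition⇒isQPartition : ∀ ρ φ → length φ ≡ length ρ →
                           IsPartition (Qrev ρ) (length ρ) (List.reverse φ) → isQPartition ρ φ ≡ true
IsPartition⇒isQPartitionStep : ∀ ρ φ → length φ ≡ length ρ → allZero ρ ≡ false →
                               IsPartition (Qrev ρ) (length ρ) (List.reverse φ) → isQPartitionStep ρ φ ≡ true

IsPartition⇒isQPartition ρ φ len p with allZero ρ in az
... | true  = refl
... | false = IsPartition⇒isQPartitionStep ρ φ len az p

IsPartition⇒isQPartitionStep (true ∷ ρ) (a ∷ φ) len _ p =
  let pg , φ≤a = IsPartition-withTop⁻ (Qrev ρ) (List.reverse φ) (trans (length-reverse φ) (suc-injective len)) a
                   (subst (IsPartition (Qrev (true ∷ ρ)) _) (unfold-reverse a φ) p)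
  in cong₂ _∧_ (IsPartition⇒isQPartition ρ φ (suc-injective len) pg) (trans (sym (all-reverse (_≤ᵇ' a) φ)) φ≤a)
IsPartition⇒isQPartitionStep (false ∷ c ∷ ρ) (w ∷ v ∷ φ) len az p =
  let pg , w<v = IsPartition-coverSwap⁻ (Qrev (c ∷ ρ)) (List.reverse φ)
                   (trans (length-reverse φ) (suc-injective (suc-injective len))) v w (Qrev-refl (c ∷ ρ) (length ρ))
                   (IsPartition-≗ {g = List.reverse φ ++ v ∷ w ∷ []} (Qrev-false (c ∷ ρ) az)
                     (subst (IsPartition (Qrev (false ∷ c ∷ ρ)) _) (reverse-∷-∷ w v φ) p))
  in cong₂ _∧_ (IsPartition⇒isQPartition (c ∷ ρ) (w ∷ φ) (suc-injective len)
                 (subst (IsPartition (Qrev (c ∷ ρ)) _) (sym (unfold-reverse w φ)) pg))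
               w<v

values-reverse : ∀ {k m} (f : Vec (Fin m) k) → values (Vec.reverse f) ≡ List.reverse (values f)
values-reverse f = trans (cong Vec.toList (map-reverse toℕ f)) (toList-reverse (Vec.map toℕ f))

length-values : ∀ {k m} (f : Vec (Fin m) k) → length (values f) ≡ k
length-values f = length-toList (Vec.map toℕ f)

isPPartition-reverse : ∀ {m} ρ (φ : Vec (Fin m) (length ρ)) →
                       isPPartition (Qrev ρ) (Vec.reverse φ) ≡ isQPartition ρ (values φ)
isPPartition-reverse ρ φ = ⇔→≡ (mk⇔
  (λ e → IsPartition⇒isQPartition ρ (values φ) (length-values φ)
           (subst (IsPartition (Qrev ρ) (length ρ)) (values-reverse φ)
             (isPPartition⇒IsPartition (Qrev ρ) (Vec.reverse φ) e)))
  (λ e → IsPartition⇒isPPartition (Qrev ρ) (Vec.reverse φ)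
           (subst (IsPartition (Qrev ρ) (length ρ)) (sym (values-reverse φ))
             (isQPartition⇒IsPartition ρ (values φ) (length-values φ) e))))

insert : ℕ → A → List A → List A
insert zero    v xs       = v ∷ xs
insert (suc i) v []       = v ∷ []
insert (suc i) v (x ∷ xs) = x ∷ insert i v xs

all-insert : ∀ (p : A → Bool) i v xs → all p (insert i v xs) ≡ p v ∧ all p xs
all-insert p zero    v xs       = refl
all-insert p (suc i) v []       = refl
all-insert p (suc i) v (x ∷ xs) rewrite all-insert p i v xs with p x
... | true  = refl
... | false = sym (∧-zeroʳ (p v))

-- The reversed word of Q_τ for each τ that occurs, with the position at which the
-- new value enters φ; the first entry is τ = σ0.
insertions : List Bool → List (List Bool × ℕ)
lowerInsertions : List Bool → List (List Bool × ℕ)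

insertions ρ = (false ∷ ρ , 1) ∷ lowerInsertions ρ

lowerInsertions []          = []
lowerInsertions (true ∷ ρ)  = map (Product.map (true ∷_) suc) (insertions ρ)
lowerInsertions (false ∷ ρ) = map (Product.map (false ∷_) suc) (lowerInsertions ρ)

lowerInsertions-allZero : ∀ ρ → allZero ρ ≡ true → lowerInsertions ρ ≡ []
lowerInsertions-allZero []          _  = refl
lowerInsertions-allZero (false ∷ ρ) az = cong (map _) (lowerInsertions-allZero ρ az)

IsLowerInsertion : List Bool × ℕ → Set
IsLowerInsertion (r , i) = allZero r ≡ false × ∃ λ j → i ≡ suc j

lowerInsertions-isLowerInsertion : ∀ ρ → All IsLowerInsertion (lowerInsertions ρ)
lowerInsertions-isLowerInsertion []          = []
lowerInsertions-isLowerInsertion (true ∷ ρ)  = map⁺ (All.universal (λ (r , i) → refl , i , refl) (insertions ρ))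
lowerInsertions-isLowerInsertion (false ∷ ρ) =
  map⁺ (All.map (λ { (az , j , refl) → az , suc j , refl }) (lowerInsertions-isLowerInsertion ρ))

∧-swapʳ : ∀ a b c → (a ∧ b) ∧ c ≡ (a ∧ c) ∧ b
∧-swapʳ true  b c = ∧-comm b c
∧-swapʳ false b c = refl

𝟙-<ᵇ+𝟙-≤ᵇ' : ∀ w v → 𝟙 (w <ᵇ v) + 𝟙 (v ≤ᵇ' w) ≡ 1
𝟙-<ᵇ+𝟙-≤ᵇ' zero    zero    = refl
𝟙-<ᵇ+𝟙-≤ᵇ' zero    (suc v) = refl
𝟙-<ᵇ+𝟙-≤ᵇ' (suc w) zero    = refl
𝟙-<ᵇ+𝟙-≤ᵇ' (suc w) (suc v) = 𝟙-<ᵇ+𝟙-≤ᵇ' w v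

-- Exactly one insertion turns φ into a partition: σ0 if v exceeds the value w of the newest
-- label, a lower insertion otherwise.
∑-insertions : ∀ ρ φ v → length φ ≡ length ρ →
               ∑[ (r , i) ← insertions ρ ] 𝟙 (isQPartition r (insert i v φ)) ≡ 𝟙 (isQPartition ρ φ)
∑-lowerInsertions : ∀ ρ w φ v → allZero ρ ≡ false → length (w ∷ φ) ≡ length ρ →
                    ∑[ (r , i) ← lowerInsertions ρ ] 𝟙 (isQPartition r (insert i v (w ∷ φ)))
                      ≡ 𝟙 (isQPartition ρ (w ∷ φ) ∧ (v ≤ᵇ' w))

∑-insertions ρ φ v len with allZero ρ in az
... | true rewrite lowerInsertions-allZero ρ az = refl
∑-insertions (b ∷ ρ) (w ∷ φ) v len | false = begin
  𝟙 (isQPartition (b ∷ ρ) (w ∷ φ) ∧ (w <ᵇ v)) + ∑[ (r , i) ← lowerInsertions (b ∷ ρ) ] _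
    ≡⟨ cong (𝟙 (isQPartition (b ∷ ρ) (w ∷ φ) ∧ (w <ᵇ v)) +_) (∑-lowerInsertions (b ∷ ρ) w φ v az len) ⟩
  𝟙 (isQPartition (b ∷ ρ) (w ∷ φ) ∧ (w <ᵇ v)) + 𝟙 (isQPartition (b ∷ ρ) (w ∷ φ) ∧ (v ≤ᵇ' w))
    ≡⟨ split (isQPartition (b ∷ ρ) (w ∷ φ)) ⟩
  𝟙 (isQPartition (b ∷ ρ) (w ∷ φ))
    ≡⟨ cong (λ a → 𝟙 (a ∨ isQPartitionStep (b ∷ ρ) (w ∷ φ))) az ⟩
  𝟙 (isQPartitionStep (b ∷ ρ) (w ∷ φ)) ∎
  where
  split : ∀ G → 𝟙 (G ∧ (w <ᵇ v)) + 𝟙 (G ∧ (v ≤ᵇ' w)) ≡ 𝟙 G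
  split true  = 𝟙-<ᵇ+𝟙-≤ᵇ' w v
  split false = refl

∑-lowerInsertions (true ∷ ρ) w φ v _ len = begin
  ∑ (map (Product.map (true ∷_) suc) (insertions ρ)) _
    ≡⟨ ∑-map _ (insertions ρ) _ ⟩
  ∑[ (r , i) ← insertions ρ ] 𝟙 (isQPartition r (insert i v φ) ∧ all (_≤ᵇ' w) (insert i v φ))
    ≡⟨ ∑-cong (insertions ρ) (λ (r , i) →
         trans (cong (λ b → 𝟙 (isQPartition r (insert i v φ) ∧ b)) (all-insert _ i v φ))
               (𝟙-∧ (isQPartition r (insert i v φ)) _)) ⟩
  ∑[ (r , i) ← insertions ρ ] (𝟙 (isQPartition r (insert i v φ)) * 𝟙 ((v ≤ᵇ' w) ∧ all (_≤ᵇ' w) φ))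
    ≡⟨ ∑-*ʳ _ (insertions ρ) (λ (r , i) → 𝟙 (isQPartition r (insert i v φ))) ⟩
  ∑[ (r , i) ← insertions ρ ] 𝟙 (isQPartition r (insert i v φ)) * 𝟙 ((v ≤ᵇ' w) ∧ all (_≤ᵇ' w) φ)
    ≡⟨ cong (_* 𝟙 ((v ≤ᵇ' w) ∧ all (_≤ᵇ' w) φ)) (∑-insertions ρ φ v (suc-injective len)) ⟩
  𝟙 (isQPartition ρ φ) * 𝟙 ((v ≤ᵇ' w) ∧ all (_≤ᵇ' w) φ)
    ≡⟨ sym (𝟙-∧ (isQPartition ρ φ) _) ⟩
  𝟙 (isQPartition ρ φ ∧ ((v ≤ᵇ' w) ∧ all (_≤ᵇ' w) φ))
    ≡⟨ cong 𝟙 (trans (sym (∧-assoc (isQPartition ρ φ) _ _)) (∧-swapʳ (isQPartition ρ φ) _ _)) ⟩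
  𝟙 ((isQPartition ρ φ ∧ all (_≤ᵇ' w) φ) ∧ (v ≤ᵇ' w)) ∎
∑-lowerInsertions (false ∷ b ∷ ρ) w (v₀ ∷ φ) v az len = begin
  ∑ (map (Product.map (false ∷_) suc) (lowerInsertions (b ∷ ρ))) _
    ≡⟨ ∑-map _ (lowerInsertions (b ∷ ρ)) _ ⟩
  ∑[ (r , i) ← lowerInsertions (b ∷ ρ) ] 𝟙 (isQPartition (false ∷ r) (w ∷ insert i v (v₀ ∷ φ)))
    ≡⟨ ∑-cong-All (lowerInsertions-isLowerInsertion (b ∷ ρ)) (λ { (r , _) (az′ , j , refl) →
         trans (cong (λ a → 𝟙 (a ∨ (isQPartition r (w ∷ insert j v φ) ∧ (w <ᵇ v₀)))) az′)
               (𝟙-∧ (isQPartition r (w ∷ insert j v φ)) (w <ᵇ v₀)) }) ⟩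
  ∑[ (r , i) ← lowerInsertions (b ∷ ρ) ] (𝟙 (isQPartition r (insert i v (w ∷ φ))) * 𝟙 (w <ᵇ v₀))
    ≡⟨ ∑-*ʳ _ (lowerInsertions (b ∷ ρ)) (λ (r , i) → 𝟙 (isQPartition r (insert i v (w ∷ φ)))) ⟩
  ∑[ (r , i) ← lowerInsertions (b ∷ ρ) ] 𝟙 (isQPartition r (insert i v (w ∷ φ))) * 𝟙 (w <ᵇ v₀)
    ≡⟨ cong (_* 𝟙 (w <ᵇ v₀)) (∑-lowerInsertions (b ∷ ρ) w φ v az (suc-injective len)) ⟩
  𝟙 (isQPartition (b ∷ ρ) (w ∷ φ) ∧ (v ≤ᵇ' w)) * 𝟙 (w <ᵇ v₀)
    ≡⟨ sym (𝟙-∧ (isQPartition (b ∷ ρ) (w ∷ φ) ∧ (v ≤ᵇ' w)) _) ⟩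
  𝟙 ((isQPartition (b ∷ ρ) (w ∷ φ) ∧ (v ≤ᵇ' w)) ∧ (w <ᵇ v₀))
    ≡⟨ cong 𝟙 (∧-swapʳ (isQPartition (b ∷ ρ) (w ∷ φ)) _ _) ⟩
  𝟙 ((isQPartition (b ∷ ρ) (w ∷ φ) ∧ (w <ᵇ v₀)) ∧ (v ≤ᵇ' w))
    ≡⟨ cong (λ a → 𝟙 ((a ∨ (isQPartition (b ∷ ρ) (w ∷ φ) ∧ (w <ᵇ v₀))) ∧ (v ≤ᵇ' w))) az ⟨
  𝟙 (isQPartition (false ∷ b ∷ ρ) (w ∷ v₀ ∷ φ) ∧ (v ≤ᵇ' w)) ∎

[]%=suc-comm : ∀ {m} (c : Vec ℕ m) (x y : Fin m) → c [ x ]%= suc [ y ]%= suc ≡ c [ y ]%= suc [ x ]%= suc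
[]%=suc-comm (a ∷ c) Fin.zero    Fin.zero    = refl
[]%=suc-comm (a ∷ c) Fin.zero    (Fin.suc y) = refl
[]%=suc-comm (a ∷ c) (Fin.suc x) Fin.zero    = refl
[]%=suc-comm (a ∷ c) (Fin.suc x) (Fin.suc y) = cong (a ∷_) ([]%=suc-comm c x y)

content-insertAt : ∀ {k m} (f : Vec (Fin m) k) (i : Fin (suc k)) (x : Fin m) →
                   content (Vec.insertAt f i x) ≡ content f [ x ]%= suc
content-insertAt f       Fin.zero    x = refl
content-insertAt (y ∷ f) (Fin.suc i) x =
  trans (cong (_[ y ]%= suc) (content-insertAt f i x)) ([]%=suc-comm (content f) x y)

content-∷ʳ : ∀ {k m} (f : Vec (Fin m) k) (x : Fin m) → content (f ∷ʳ x) ≡ content f [ x ]%= suc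
content-∷ʳ []      x = refl
content-∷ʳ (y ∷ f) x = trans (cong (_[ y ]%= suc) (content-∷ʳ f x)) ([]%=suc-comm (content f) x y)

content-reverse : ∀ {k m} (f : Vec (Fin m) k) → content (Vec.reverse f) ≡ content f
content-reverse []      = refl
content-reverse (y ∷ f) = begin
  content (Vec.reverse (y ∷ f))        ≡⟨ cong content (reverse-∷ y f) ⟩
  content (Vec.reverse f ∷ʳ y)         ≡⟨ content-∷ʳ (Vec.reverse f) y ⟩
  content (Vec.reverse f) [ y ]%= suc  ≡⟨ cong (_[ y ]%= suc) (content-reverse f) ⟩
  content f [ y ]%= suc                ∎

clamp : ℕ → (k : ℕ) → Fin (suc k)
clamp zero    k       = Fin.zero
clamp (suc i) zero    = Fin.zero
clamp (suc i) (suc k) = Fin.suc (clamp i k)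

insert-values : ∀ {k m} (φ : Vec (Fin m) k) i (x : Fin m) →
                insert i (toℕ x) (values φ) ≡ values (Vec.insertAt φ (clamp i k) x)
insert-values φ       zero    x = refl
insert-values []      (suc i) x = refl
insert-values (y ∷ φ) (suc i) x = cong (toℕ y ∷_) (insert-values φ i x)

insertions-length : ∀ ρ → All (λ (r , _) → length r ≡ suc (length ρ)) (insertions ρ)
insertions-length ρ = refl ∷ lower ρ
  where
  lower : ∀ ρ → All (λ (r , _) → length r ≡ suc (length ρ)) (lowerInsertions ρ)
  lower []          = []
  lower (true ∷ ρ)  = map⁺ (All.map (cong suc) (insertions-length ρ))
  lower (false ∷ ρ) = map⁺ (All.map (cong suc) (lower ρ))

module _ (m : ℕ) (α : Vec ℕ m) where

  private
    vecs : (k : ℕ) → List (Vec (Fin m) k)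
    vecs = allVecs (Fin m) (finList m)

    weight : ∀ {k} → List Bool → Vec (Fin m) k → ℕ
    weight ρ φ = 𝟙 (isQPartition ρ (values φ)) * 𝟙 (eqVec (content φ) α)

  coeffF-Qrev : ∀ ρ {k} → length ρ ≡ k → coeffF k (Qrev ρ) m α ≡ ∑[ φ ← vecs k ] weight ρ φ
  coeffF-Qrev ρ refl = begin
    coeffF (length ρ) (Qrev ρ) m α
      ≡⟨ length-filterᵇ _ (vecs (length ρ)) ⟩
    ∑[ f ← vecs (length ρ) ] 𝟙 (isPPartition (Qrev ρ) f ∧ eqVec (content f) α)
      ≡⟨ ∑-allVecs-reverse (finList m) (length ρ) _ ⟩
    ∑[ φ ← vecs (length ρ) ] 𝟙 (isPPartition (Qrev ρ) (Vec.reverse φ) ∧ eqVec (content (Vec.reverse φ)) α)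
      ≡⟨ ∑-cong (vecs (length ρ)) (λ φ → trans
           (cong₂ (λ a b → 𝟙 (a ∧ eqVec b α)) (isPPartition-reverse ρ φ) (content-reverse φ))
           (𝟙-∧ (isQPartition ρ (values φ)) _)) ⟩
    ∑[ φ ← vecs (length ρ) ] weight ρ φ ∎

  coeffFL1-Qrev : ∀ ρ {k} → length ρ ≡ k →
                  coeffFL1 k (Qrev ρ) m α
                    ≡ ∑[ x ← finList m ] ∑[ φ ← vecs k ]
                        (𝟙 (isQPartition ρ (values φ)) * 𝟙 (eqVec (content φ [ x ]%= suc) α))
  coeffFL1-Qrev ρ refl = begin
    coeffFL1 (length ρ) (Qrev ρ) m α
      ≡⟨ length-filterᵇ _ (List.cartesianProduct (finList m) (vecs (length ρ))) ⟩
    ∑ (List.cartesianProduct (finList m) (vecs (length ρ))) _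
      ≡⟨ ∑-cartesianProduct (finList m) (vecs (length ρ)) _ ⟩
    ∑[ x ← finList m ] ∑[ f ← vecs (length ρ) ] 𝟙 (isPPartition (Qrev ρ) f ∧ eqVec (content f [ x ]%= suc) α)
      ≡⟨ ∑-cong (finList m) (λ x → ∑-allVecs-reverse (finList m) (length ρ) _) ⟩
    ∑[ x ← finList m ] ∑[ φ ← vecs (length ρ) ]
      𝟙 (isPPartition (Qrev ρ) (Vec.reverse φ) ∧ eqVec (content (Vec.reverse φ) [ x ]%= suc) α)
      ≡⟨ ∑-cong (finList m) (λ x → ∑-cong (vecs (length ρ)) λ φ → trans
           (cong₂ (λ a b → 𝟙 (a ∧ eqVec (b [ x ]%= suc) α)) (isPPartition-reverse ρ φ) (content-reverse φ))
           (𝟙-∧ (isQPartition ρ (values φ)) _)) ⟩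
    ∑[ x ← finList m ] ∑[ φ ← vecs (length ρ) ]
      (𝟙 (isQPartition ρ (values φ)) * 𝟙 (eqVec (content φ [ x ]%= suc) α)) ∎

  weight-insertAt : ∀ {k} r i x (φ : Vec (Fin m) k) →
                    weight r (Vec.insertAt φ (clamp i k) x)
                      ≡ 𝟙 (isQPartition r (insert i (toℕ x) (values φ))) * 𝟙 (eqVec (content φ [ x ]%= suc) α)
  weight-insertAt {k} r i x φ = cong₂ _*_
    (cong (𝟙 ∘ isQPartition r) (sym (insert-values φ i x)))
    (cong (λ c → 𝟙 (eqVec c α)) (content-insertAt φ (clamp i k) x))

  coeffFL1≡∑-insertions : ∀ ρ {k} → length ρ ≡ k →
                          coeffFL1 k (Qrev ρ) m α ≡ ∑[ (r , _) ← insertions ρ ] coeffF (suc k) (Qrev r) m α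
  coeffFL1≡∑-insertions ρ {k} len = begin
    coeffFL1 k (Qrev ρ) m α
      ≡⟨ coeffFL1-Qrev ρ len ⟩
    ∑[ x ← finList m ] ∑[ φ ← vecs k ] (𝟙 (isQPartition ρ (values φ)) * hits x φ)
      ≡⟨ ∑-cong (finList m) (λ x → ∑-cong (vecs k) λ φ → trans
           (cong (_* hits x φ) (sym (∑-insertions ρ (values φ) (toℕ x) (trans (length-values φ) (sym len)))))
           (sym (∑-*ʳ (hits x φ) (insertions ρ) λ (r , i) → 𝟙 (isQPartition r (insert i (toℕ x) (values φ)))))) ⟩
    ∑[ x ← finList m ] ∑[ φ ← vecs k ] ∑[ (r , i) ← insertions ρ ]
      (𝟙 (isQPartition r (insert i (toℕ x) (values φ))) * hits x φ)
      ≡⟨ ∑-cong (finList m) (λ x → ∑-cong (vecs k) λ φ → ∑-cong (insertions ρ) λ (r , i) →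
           sym (weight-insertAt r i x φ)) ⟩
    ∑[ x ← finList m ] ∑[ φ ← vecs k ] ∑[ (r , i) ← insertions ρ ] weight r (Vec.insertAt φ (clamp i k) x)
      ≡⟨ ∑-cong (finList m) (λ x → ∑-comm (vecs k) (insertions ρ) _) ⟩
    ∑[ x ← finList m ] ∑[ (r , i) ← insertions ρ ] ∑[ φ ← vecs k ] weight r (Vec.insertAt φ (clamp i k) x)
      ≡⟨ ∑-comm (finList m) (insertions ρ) _ ⟩
    ∑[ (r , i) ← insertions ρ ] ∑[ x ← finList m ] ∑[ φ ← vecs k ] weight r (Vec.insertAt φ (clamp i k) x)
      ≡⟨ ∑-cong (insertions ρ) (λ (r , i) → sym (∑-allVecs-insertAt (finList m) k (clamp i k) (weight r))) ⟩
    ∑[ (r , _) ← insertions ρ ] ∑[ ψ ← vecs (suc k) ] weight r ψ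
      ≡⟨ ∑-cong-All (insertions-length ρ) (λ (r , _) len-r → sym (coeffF-Qrev r (trans len-r (cong suc len)))) ⟩
    ∑[ (r , _) ← insertions ρ ] coeffF (suc k) (Qrev r) m α ∎
    where
    hits : Fin m → Vec (Fin m) k → ℕ
    hits x φ = 𝟙 (eqVec (content φ [ x ]%= suc) α)

-- Lexicographic order and multiplicities

SplitsBelow : List Bool → List Bool → Set
SplitsBelow u w = ∃ λ P → ∃ λ X → ∃ λ Y → u ≡ P ++ false ∷ X × w ≡ P ++ true ∷ Y

SplitsBelow-reverse-∷ : ∀ b {r ρ} → SplitsBelow (List.reverse r) (List.reverse ρ) →
                        SplitsBelow (List.reverse (b ∷ r)) (List.reverse (b ∷ ρ))
SplitsBelow-reverse-∷ b {r} {ρ} (P , X , Y , r≡ , ρ≡) =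
  P , X ++ b ∷ [] , Y ++ b ∷ [] ,
  trans (unfold-reverse b r) (trans (cong (_++ b ∷ []) r≡) (++-assoc P (false ∷ X) (b ∷ []))) ,
  trans (unfold-reverse b ρ) (trans (cong (_++ b ∷ []) ρ≡) (++-assoc P (true ∷ Y) (b ∷ [])))

lowerInsertions-below : ∀ ρ →
                        All (λ (r , _) → SplitsBelow (List.reverse r) (List.reverse ρ)) (lowerInsertions ρ)
lowerInsertions-below []          = []
lowerInsertions-below (true ∷ ρ)  =
  map⁺ (head ∷ All.map (λ {x} → SplitsBelow-reverse-∷ true {proj₁ x} {ρ}) (lowerInsertions-below ρ))
  where
  head : SplitsBelow (List.reverse (true ∷ false ∷ ρ)) (List.reverse (true ∷ ρ))
  head = List.reverse ρ , true ∷ [] , [] ,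
         trans (unfold-reverse true (false ∷ ρ))
           (trans (cong (_++ true ∷ []) (unfold-reverse false ρ))
                  (++-assoc (List.reverse ρ) (false ∷ []) (true ∷ []))) ,
         unfold-reverse true ρ
lowerInsertions-below (false ∷ ρ) =
  map⁺ (All.map (λ {x} → SplitsBelow-reverse-∷ false {proj₁ x} {ρ}) (lowerInsertions-below ρ))

<lex-split : ∀ {n} (u w : Vec Bool n) P X Y →
             Vec.toList u ≡ P ++ false ∷ X → Vec.toList w ≡ P ++ true ∷ Y → (u <lex w) ≡ true
<lex-split (a ∷ u) (b ∷ w) [] X Y u≡ w≡ with ∷-injective u≡ | ∷-injective w≡
... | refl , _ | refl , _ = refl
<lex-split (a ∷ u) (b ∷ w) (true ∷ P) X Y u≡ w≡ with ∷-injective u≡ | ∷-injective w≡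
... | refl , u≡′ | refl , w≡′ = <lex-split u w P X Y u≡′ w≡′
<lex-split (a ∷ u) (b ∷ w) (false ∷ P) X Y u≡ w≡ with ∷-injective u≡ | ∷-injective w≡
... | refl , u≡′ | refl , w≡′ = <lex-split u w P X Y u≡′ w≡′

padded : (k : ℕ) → List Bool → Vec Bool k
padded zero    _        = []
padded (suc k) []       = false ∷ padded k []
padded (suc k) (b ∷ bs) = b ∷ padded k bs

toList-padded : ∀ k bs → length bs ≡ k → Vec.toList (padded k bs) ≡ bs
toList-padded zero    []       _   = refl
toList-padded (suc k) (b ∷ bs) len = cong (b ∷_) (toList-padded k bs (suc-injective len))

module _ {n : ℕ} (s : Vec Bool n) where

  private
    σ : Vec Bool (suc n)
    σ = false ∷ s

    ρ : List Bool
    ρ = Vec.toList (Vec.reverse σ)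

    reverse-ρ : List.reverse ρ ≡ false ∷ Vec.toList s
    reverse-ρ = trans (cong List.reverse (toList-reverse σ)) (reverse-involutive (Vec.toList σ))

  length-ρ : length ρ ≡ suc n
  length-ρ = length-toList (Vec.reverse σ)

  toList-reverse-σ0 : Vec.toList (Vec.reverse (σ ∷ʳ false)) ≡ false ∷ ρ
  toList-reverse-σ0 = begin
    Vec.toList (Vec.reverse (σ ∷ʳ false))     ≡⟨ toList-reverse (σ ∷ʳ false) ⟩
    List.reverse (Vec.toList (σ ∷ʳ false))    ≡⟨ cong List.reverse (toList-∷ʳ false σ) ⟩
    List.reverse (Vec.toList σ ++ false ∷ []) ≡⟨ reverse-++ (Vec.toList σ) (false ∷ []) ⟩
    false ∷ List.reverse (Vec.toList σ)       ≡⟨ cong (false ∷_) (toList-reverse σ) ⟨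
    false ∷ ρ                                 ∎

  -- t with τ = 0t, read off the reversed word r of τ; the padding is junk that never occurs.
  wordOf : List Bool → Vec Bool (suc n)
  wordOf r = padded (suc n) (List.drop 1 (List.reverse r))

  LowerWord : List Bool → Set
  LowerWord r = Vec.toList (Vec.reverse (false ∷ wordOf r)) ≡ r
              × ((false ∷ wordOf r) <lex (σ ∷ʳ false)) ≡ true

  splitsBelow⇒LowerWord : ∀ r → SplitsBelow (List.reverse r) (List.reverse ρ) → length r ≡ suc (suc n) →
                          LowerWord r
  splitsBelow⇒LowerWord r (false ∷ P , X , Y , r≡ , ρ≡) len =
    reverse-wordOf ,
    <lex-split (false ∷ wordOf r) (σ ∷ʳ false) (false ∷ P) X (Y ++ false ∷ []) (trans toList-wordOf r≡) σ0≡
    where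
    toList-wordOf : Vec.toList (false ∷ wordOf r) ≡ List.reverse r
    toList-wordOf = begin
      false ∷ Vec.toList (padded (suc n) (List.drop 1 (List.reverse r)))
        ≡⟨ cong (λ u → false ∷ Vec.toList (padded (suc n) (List.drop 1 u))) r≡ ⟩
      false ∷ Vec.toList (padded (suc n) (P ++ false ∷ X))
        ≡⟨ cong (false ∷_) (toList-padded (suc n) (P ++ false ∷ X)
             (suc-injective (trans (cong length (sym r≡)) (trans (length-reverse r) len)))) ⟩
      false ∷ P ++ false ∷ X
        ≡⟨ r≡ ⟨
      List.reverse r ∎
    reverse-wordOf : Vec.toList (Vec.reverse (false ∷ wordOf r)) ≡ r
    reverse-wordOf = trans (toList-reverse (false ∷ wordOf r))
                           (trans (cong List.reverse toList-wordOf) (reverse-involutive r))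
    σ0≡ : Vec.toList (σ ∷ʳ false) ≡ (false ∷ P) ++ true ∷ Y ++ false ∷ []
    σ0≡ = begin
      Vec.toList (σ ∷ʳ false)                 ≡⟨ toList-∷ʳ false σ ⟩
      Vec.toList σ ++ false ∷ []              ≡⟨ cong (_++ false ∷ []) (trans (sym reverse-ρ) ρ≡) ⟩
      (false ∷ P ++ true ∷ Y) ++ false ∷ []   ≡⟨ ++-assoc (false ∷ P) (true ∷ Y) (false ∷ []) ⟩
      false ∷ P ++ true ∷ Y ++ false ∷ []     ∎
  splitsBelow⇒LowerWord r ([]       , _ , _ , _ , ρ≡) _ =
    ⊥-elim (false≢true (∷-injectiveˡ (trans (sym reverse-ρ) ρ≡)))
  splitsBelow⇒LowerWord r (true ∷ _ , _ , _ , _ , ρ≡) _ =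
    ⊥-elim (false≢true (∷-injectiveˡ (trans (sym reverse-ρ) ρ≡)))

  lowerInsertions-LowerWord : All (λ (r , _) → LowerWord r) (lowerInsertions ρ)
  lowerInsertions-LowerWord with insertions-length ρ
  ... | _ ∷ lengths = All.zipWith
    (λ {(r , _)} (splits , len) → splitsBelow⇒LowerWord r splits (trans len (cong suc length-ρ)))
    (lowerInsertions-below ρ , lengths)

  multiplicity : Vec Bool (suc n) → ℕ
  multiplicity t = ∑[ (r , _) ← lowerInsertions ρ ] 𝟙 (does (≡-decᵛ _≟ᴮ_ t (wordOf r)))

  module _ (X : List Bool → ℕ) where

    private
      isWord : Vec Bool (suc n) → List Bool → ℕ
      isWord t r = 𝟙 (does (≡-decᵛ _≟ᴮ_ t (wordOf r)))

      term : Vec Bool (suc n) → ℕ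
      term t = if (false ∷ t) <lex (σ ∷ʳ false)
               then multiplicity t * X (Vec.toList (Vec.reverse (false ∷ t)))
               else 0

      term≡∑ : ∀ t → term t ≡ ∑[ (r , _) ← lowerInsertions ρ ] (isWord t r * X r)
      term≡∑ t with (false ∷ t) <lex (σ ∷ʳ false) in lex
      ... | true  = trans (sym (∑-*ʳ _ (lowerInsertions ρ) (isWord t ∘ proj₁)))
                          (∑-cong-All lowerInsertions-LowerWord λ (r , _) → same r)
        where
        same : ∀ r → LowerWord r → isWord t r * X (Vec.toList (Vec.reverse (false ∷ t))) ≡ isWord t r * X r
        same r (reverse≡ , _) with ≡-decᵛ _≟ᴮ_ t (wordOf r)
        ... | yes refl = cong (λ r′ → 1 * X r′) reverse≡
        ... | no  _    = refl
      ... | false =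
        sym (trans (∑-cong-All lowerInsertions-LowerWord λ (r , _) → absent r) (∑-zero (lowerInsertions ρ)))
        where
        absent : ∀ r → LowerWord r → isWord t r * X r ≡ 0
        absent r (_ , lower) with ≡-decᵛ _≟ᴮ_ t (wordOf r)
        ... | yes refl = ⊥-elim (false≢true (trans (sym lex) lower))
        ... | no  _    = refl

    ∑-lowerInsertions≡∑-words : ∑[ (r , _) ← lowerInsertions ρ ] X r ≡ sumℕ (map term (words (suc n)))
    ∑-lowerInsertions≡∑-words = sym (begin
      ∑[ t ← words (suc n) ] term t
        ≡⟨ ∑-cong (words (suc n)) term≡∑ ⟩
      ∑[ t ← words (suc n) ] ∑[ (r , _) ← lowerInsertions ρ ] (isWord t r * X r)
        ≡⟨ ∑-comm (words (suc n)) (lowerInsertions ρ) _ ⟩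
      ∑[ (r , _) ← lowerInsertions ρ ] ∑[ t ← words (suc n) ] (isWord t r * X r)
        ≡⟨ ∑-cong (lowerInsertions ρ) (λ (r , _) → trans (∑-*ʳ (X r) (words (suc n)) (λ t → isWord t r))
                                                    (cong (_* X r) (words-unique (wordOf r)))) ⟩
      ∑[ (r , _) ← lowerInsertions ρ ] (1 * X r)
        ≡⟨ ∑-cong (lowerInsertions ρ) (λ (r , _) → *-identityˡ (X r)) ⟩
      ∑[ (r , _) ← lowerInsertions ρ ] X r ∎)
      where
      words-unique : ∀ u → ∑[ t ← words (suc n) ] 𝟙 (does (≡-decᵛ _≟ᴮ_ t u)) ≡ 1
      words-unique = allVecs-unique (false ∷ true ∷ []) _≟ᴮ_ (λ { false → refl ; true → refl }) (suc n)

-- σ = 0s has length suc n (the paper's n) and τ = 0t has length suc (suc n).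
lemma10p14 : ∀ {n} (s : Vec Bool n) →
    ∃ λ (c : Vec Bool (suc n) → ℕ) →
      ∀ (m : ℕ) (α : Vec ℕ m) →
        coeffFL1 (suc n) (Q (false ∷ s)) m α
          ≡ coeffF (suc (suc n)) (Q ((false ∷ s) ∷ʳ false)) m α
            + sumℕ (map (λ t → if (false ∷ t) <lex ((false ∷ s) ∷ʳ false)
                                then c t * coeffF (suc (suc n)) (Q (false ∷ t)) m α
                                else 0)
                        (words (suc n)))
lemma10p14 {n} s = multiplicity s , λ m α →
  let coeff r = coeffF (suc (suc n)) (Qrev r) m α in
  trans (coeffFL1≡∑-insertions m α (Vec.toList (Vec.reverse (false ∷ s))) (length-ρ s))
        (cong₂ _+_ (cong coeff (sym (toList-reverse-σ0 s))) (∑-lowerInsertions≡∑-words s coeff))
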